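{- Every Young subgroup $\mathrm{Sym}(\lambda)\leq\mathrm{Sym}(n)$, with its natural action on $\{1,\dots,n\}$, has the EKR property.
   Context: For a partition $\lambda=[\lambda_1,\dots,\lambda_k]$ of $n$ ($\lambda_1\geq\cdots\geq\lambda_k\geq1$, $\sum\lambda_i=n$), let $\Omega_i=\{\lambda_1+\cdots+\lambda_{i-1}+1,\dots,\lambda_1+\cdots+\lambda_i\}$. The Young subgroup $\mathrm{Sym}(\lambda)$ is the internal direct product $\mathrm{Sym}(\Omega_1)\cdots\mathrm{Sym}(\Omega_k)$, i.e. the subgroup of $\mathrm{Sym}(n)$ of permutations preserving each $\Omega_i$. Two elements $\pi,\tau$ intersect if $\pi\tau^{ -1}$ has a fixed point; a subset is intersecting if every pair of its elements intersect. A permutation group has the EKR property if every intersecting subset has size at most the size of the largest point-stabilizer. -}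

module Defs where

open import Data.Nat using (ℕ; zero; suc; _≤_; _<_; _<ᵇ_; _∸_)
open import Data.Bool using (if_then_else_)
open import Data.Fin using (Fin; toℕ)
open import Data.Fin.Permutation using (Permutation′; _⟨$⟩ʳ_; _∘ₚ_; flip)
open import Data.List using (List; []; _∷_; length)
open import Data.Nat.ListAction using (sum)
open import Data.Unit using (⊤)
open import Data.List.Relation.Unary.All using (All)
open import Data.List.Relation.Unary.Any using (Any)
open import Data.List.Relation.Unary.AllPairs using (AllPairs)
open import Data.List.Relation.Binary.Pointwise using (Pointwise)
open import Data.Product using (Σ; ∃; _×_)
open import Relation.Nullary using (¬_)
open import Relation.Binary.PropositionalEquality using (_≡_)

-- Elements of Sym(n): permutations of the points Fin n = {0,…,n-1}
-- (point i stands for the paper's point i+1).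
Perm : ℕ → Set
Perm n = Permutation′ n

_≈ₚ_ : ∀ {n} → Perm n → Perm n → Set
π ≈ₚ τ = ∀ i → π ⟨$⟩ʳ i ≡ τ ⟨$⟩ʳ i

Distinct : ∀ {n} → Perm n → Perm n → Set
Distinct π τ = ¬ (π ≈ₚ τ)

-- π τ⁻¹ (apply τ⁻¹ first, then π).
_·inv_ : ∀ {n} → Perm n → Perm n → Perm n
π ·inv τ = flip τ ∘ₚ π

Intersect : ∀ {n} → Perm n → Perm n → Set
Intersect π τ = ∃ λ i → (π ·inv τ) ⟨$⟩ʳ i ≡ i

-- A permutation group G ≤ Sym(n), given by its membership predicate.
-- A finite subset of G is given as a duplicate-free list of elements of G.
IsSubsetOf : ∀ {n} → (Perm n → Set) → List (Perm n) → Set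
IsSubsetOf G S = All G S × AllPairs Distinct S

IsIntersecting : ∀ {n} → (Perm n → Set) → List (Perm n) → Set
IsIntersecting G S = IsSubsetOf G S × AllPairs Intersect S

EnumeratesStabilizer : ∀ {n} → (Perm n → Set) → Fin n → List (Perm n) → Set
EnumeratesStabilizer G x T =
  All (λ σ → G σ × σ ⟨$⟩ʳ x ≡ x) T × AllPairs Distinct T ×
  (∀ σ → G σ → σ ⟨$⟩ʳ x ≡ x → Any (λ τ → σ ≈ₚ τ) T)

-- EKR property: every intersecting subset has size at most the size of
-- the largest point-stabilizer, i.e. at most |G_x| for some point x.
EKR : ∀ {n} → (Perm n → Set) → Set
EKR {n} G = ∀ (S : List (Perm n)) → IsIntersecting G S →
  ∃ λ (x : Fin n) → ∃ λ (T : List (Perm n)) →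
    EnumeratesStabilizer G x T × length S ≤ length T

Nonincreasing : List ℕ → Set
Nonincreasing [] = ⊤
Nonincreasing (a ∷ []) = ⊤
Nonincreasing (a ∷ b ∷ l) = b ≤ a × Nonincreasing (b ∷ l)

IsPartition : ℕ → List ℕ → Set
IsPartition n λs =
  ¬ (λs ≡ []) × All (λ a → 1 ≤ a) λs × Nonincreasing λs × sum λs ≡ n

-- block λ m = j (0-based) iff the 0-based point m lies in Ω_{j+1},
-- i.e. λ₁+⋯+λ_j ≤ m < λ₁+⋯+λ_{j+1}.
block : List ℕ → ℕ → ℕ
block [] m = 0
block (a ∷ λs) m = if m <ᵇ a then 0 else suc (block λs (m ∸ a))

InYoung : ∀ {n} → List ℕ → Perm n → Set
InYoung λs σ = ∀ i → block λs (toℕ (σ ⟨$⟩ʳ i)) ≡ block λs (toℕ i)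

-- Let Ω be a smallest block of λ, of size c, and x its first point. The permutations
-- hᵣ (r < c) rotating every block cyclically by r lie in Sym(λ) and send x to every
-- point of Ω; since c is at most every block size, hᵣ and hₛ disagree at every point
-- when r ≠ s. So each σ ∈ Sym(λ) factors as σ = hᵣ τ with τ fixing x, and two
-- intersecting permutations with the same τ coincide (they share a point p with
-- hᵣ τ p = hₛ τ p, forcing r = s). Hence σ ↦ τ embeds any intersecting set into the
-- stabilizer of x.
module Submission where

open import Defs
open import Data.Bool using (true; false; if_then_else_)
open import Data.Empty using (⊥)
open import Data.Fin using (Fin; zero; suc; toℕ; fromℕ<; punchIn) renaming (_<_ to _<ᶠ_)
open import Data.Fin.Permutation
  using (_⟨$⟩ʳ_; _⟨$⟩ˡ_; _∘ₚ_; flip; permutation; insert; remove; insert-punchIn; insert-remove; inverseˡ; inverseʳ)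
  renaming (id to idₚ)
open import Data.Fin.Properties using (all?; pigeonhole; toℕ-fromℕ<; toℕ-injective; toℕ<n) renaming (_≟_ to _≟ᶠ_)
open import Data.List using (List; []; _∷_; _++_; length; lookup; map; concatMap; allFin; filter; deduplicate)
open import Data.List.Extrema.Nat using (min; min≤⊤; min≤xs; argmin-sel)
open import Data.List.Membership.Propositional using (_∈_)
open import Data.List.Membership.Propositional.Properties using (∈-lookup; ∈-allFin; ∈-∃++)
open import Data.List.Relation.Unary.All as All using (All; []; _∷_)
import Data.List.Relation.Unary.All.Properties as All
open import Data.List.Relation.Unary.Any as Any using (Any; here; there)
import Data.List.Relation.Unary.Any.Properties as Any
open import Data.List.Relation.Unary.AllPairs as AllPairs using (AllPairs; _∷_)
open import Data.List.Relation.Unary.Unique.DecSetoid.Properties using (deduplicate-!)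
open import Data.Nat using (ℕ; zero; suc; _+_; _∸_; _<_; _≤_; _<ᵇ_; z≤n; z<s; s≤s; NonZero; _≟_; _<?_)
open import Data.Nat.DivMod using (_%_; m%n<n; m<n⇒m%n≡m; %-distribˡ-+; m%n%n≡m%n; [m+n]%n≡m%n)
open import Data.Nat.ListAction using (sum)
open import Data.Nat.ListAction.Properties using (sum-++)
open import Data.Nat.Properties
  using ( ≮⇒≥; <⇒≤; ≤-trans; <-≤-trans; m≤m+n; m<m+n; +-monoʳ-<; +-cancelˡ-<; +-cancelˡ-≡; suc-injective
        ; +-assoc; +-comm; +-identityʳ; m+[n∸m]≡n; m+n∸m≡n; m∸[m∸n]≡n; m∸n≤m )
open import Data.Product using (∃; Σ; _×_; _,_; proj₁; proj₂)
open import Data.Sum using (inj₁; inj₂; [_,_]′)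
open import Function using (id; _∘_)
open import Level using (0ℓ)
open import Relation.Binary.Bundles using (DecSetoid)
open import Relation.Binary.Structures using (IsEquivalence)
open import Relation.Binary.PropositionalEquality using (_≡_; refl; sym; trans; cong; cong₂; subst; module ≡-Reasoning)
open import Relation.Nullary using (¬_; Dec; yes; no; contradiction)
open import Relation.Nullary.Decidable using (_×-dec_)
open import Relation.Unary using (Decidable)

private
  variable
    A B : Set
    n : ℕ

allPairs-lookup : ∀ {R : A → A → Set} {xs : List A} {i j : Fin (length xs)} →
                  AllPairs R xs → i <ᶠ j → R (lookup xs i) (lookup xs j)
allPairs-lookup {i = zero}  {suc j} (Rx ∷ _)   _         = All.lookup Rx (∈-lookup j)
allPairs-lookup {i = suc i} {suc j} (_  ∷ Rxs) (s≤s i<j) = allPairs-lookup Rxs i<j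

placement⇒length≤ : ∀ {Placed : A → B → Set} {S : List A} {T : List B} →
                    All (λ a → Any (Placed a) T) S →
                    AllPairs (λ a a′ → ∀ {b} → Placed a b → Placed a′ b → ⊥) S →
                    length S ≤ length T
placement⇒length≤ {Placed = Placed} {S} {T} placed apart = ≮⇒≥ λ |T|<|S| →
  let i , j , i<j , same = pigeonhole |T|<|S| slot in
  allPairs-lookup apart i<j (Any.lookup-index (placedAt i))
    (subst (λ k → Placed (lookup S j) (lookup T k)) (sym same) (Any.lookup-index (placedAt j)))
  where
  placedAt : ∀ i → Any (Placed (lookup S i)) T
  placedAt i = All.lookup placed (∈-lookup i)

  slot : Fin (length S) → Fin (length T)
  slot i = Any.index (placedAt i)

minimum : ∀ (l : List ℕ) → ¬ l ≡ [] → ∃ λ c → c ∈ l × All (c ≤_) l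
minimum []      l≢[] = contradiction refl l≢[]
minimum (a ∷ l) _    = min a l , [ here , there ]′ (argmin-sel id a l) , min≤⊤ a l ∷ min≤xs a l

≈ₚ-isEquivalence : IsEquivalence (_≈ₚ_ {n})
≈ₚ-isEquivalence = record
  { refl  = λ _ → refl
  ; sym   = λ π≈τ i → sym (π≈τ i)
  ; trans = λ π≈ρ ρ≈τ i → trans (π≈ρ i) (ρ≈τ i)
  }

_≈ₚ?_ : (π τ : Perm n) → Dec (π ≈ₚ τ)
π ≈ₚ? τ = all? λ i → π ⟨$⟩ʳ i ≟ᶠ τ ⟨$⟩ʳ i

permutationDecSetoid : ℕ → DecSetoid 0ℓ 0ℓ
permutationDecSetoid n = record
  { Carrier          = Perm n
  ; _≈_              = _≈ₚ_
  ; isDecEquivalence = record { isEquivalence = ≈ₚ-isEquivalence ; _≟_ = _≈ₚ?_ }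
  }

insert₀-cong : ∀ (j : Fin (suc n)) {π ρ : Perm n} → π ≈ₚ ρ → insert zero j π ≈ₚ insert zero j ρ
insert₀-cong j         π≈ρ zero    = refl
insert₀-cong j {π} {ρ} π≈ρ (suc k) = begin
  insert zero j π ⟨$⟩ʳ suc k ≡⟨ insert-punchIn zero j π k ⟩
  punchIn j (π ⟨$⟩ʳ k)       ≡⟨ cong (punchIn j) (π≈ρ k) ⟩
  punchIn j (ρ ⟨$⟩ʳ k)       ≡⟨ insert-punchIn zero j ρ k ⟨
  insert zero j ρ ⟨$⟩ʳ suc k ∎
  where open ≡-Reasoning

allPermutations : ∀ n → List (Perm n)
allPermutations zero    = idₚ ∷ []
allPermutations (suc n) = concatMap (λ j → map (insert zero j) (allPermutations n)) (allFin (suc n))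

allPermutations-complete : ∀ n (π : Perm n) → Any (π ≈ₚ_) (allPermutations n)
allPermutations-complete zero    π = here λ ()
allPermutations-complete (suc n) π = Any.concatMap⁺ _ (Any.map insertions (∈-allFin (π ⟨$⟩ʳ zero)))
  where
  reinsert : ∀ {ρ} → remove zero π ≈ₚ ρ → π ≈ₚ insert zero (π ⟨$⟩ʳ zero) ρ
  reinsert π₀≈ρ i = trans (sym (insert-remove zero π i)) (insert₀-cong (π ⟨$⟩ʳ zero) π₀≈ρ i)

  insertions : ∀ {j} → π ⟨$⟩ʳ zero ≡ j → Any (π ≈ₚ_) (map (insert zero j) (allPermutations n))
  insertions refl = Any.map⁺ (Any.map reinsert (allPermutations-complete n (remove zero π)))

enumerate : ∀ {P : Perm n → Set} → Decidable P → (∀ {σ τ} → σ ≈ₚ τ → P σ → P τ) →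
            Σ (List (Perm n)) λ T → All P T × AllPairs Distinct T × (∀ σ → P σ → Any (σ ≈ₚ_) T)
enumerate {n} {P} P? P-resp = T , All.deduplicate⁺ _≈ₚ?_ (All.all-filter P? (allPermutations n))
                                , deduplicate-! (permutationDecSetoid n) (filter P? (allPermutations n)) , complete
  where
  T : List (Perm n)
  T = deduplicate _≈ₚ?_ (filter P? (allPermutations n))

  complete : ∀ σ → P σ → Any (σ ≈ₚ_) T
  complete σ Pσ with Any.filter⁺ P? (allPermutations-complete n σ)
  ... | inj₁ σ∈filtered = Any.deduplicate⁺ _≈ₚ?_ (λ ρ≈τ σ≈τ i → trans (σ≈τ i) (sym (ρ≈τ i))) σ∈filtered
  ... | inj₂ ¬Pρ        = contradiction (P-resp (Any.lookup-result (allPermutations-complete n σ)) Pσ) ¬Pρ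

record BijectionBelow (N : ℕ) : Set where
  field
    to      : ℕ → ℕ
    from    : ℕ → ℕ
    to-<    : ∀ {m} → m < N → to m < N
    from-<  : ∀ {m} → m < N → from m < N
    from∘to : ∀ {m} → m < N → from (to m) ≡ m
    to∘from : ∀ {m} → m < N → to (from m) ≡ m

module _ {N : ℕ} where

  restrict : (f : ℕ → ℕ) → (∀ {m} → m < N → f m < N) → Fin N → Fin N
  restrict f f< i = fromℕ< (f< (toℕ<n i))

  restrict-inverse : ∀ f g (f< : ∀ {m} → m < N → f m < N) (g< : ∀ {m} → m < N → g m < N) →
                     (∀ {m} → m < N → f (g m) ≡ m) →
                     ∀ i → restrict f f< (restrict g g< i) ≡ i
  restrict-inverse f g f< g< f∘g i = toℕ-injective (begin
    toℕ (restrict f f< (restrict g g< i)) ≡⟨ toℕ-fromℕ< _ ⟩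
    f (toℕ (restrict g g< i))             ≡⟨ cong f (toℕ-fromℕ< _) ⟩
    f (g (toℕ i))                         ≡⟨ f∘g (toℕ<n i) ⟩
    toℕ i                                 ∎)
    where open ≡-Reasoning

  toPermutation : BijectionBelow N → Perm N
  toPermutation b = permutation (restrict to to-<) (restrict from from-<)
    (restrict-inverse to from to-< from-< to∘from) (restrict-inverse from to from-< to-< from∘to)
    where open BijectionBelow b

  toℕ-toPermutation : ∀ b i → toℕ (toPermutation b ⟨$⟩ʳ i) ≡ BijectionBelow.to b (toℕ i)
  toℕ-toPermutation b i = toℕ-fromℕ< _

-- EKR from a sharp transversal

record IsPermutationGroup (G : Perm n → Set) : Set where
  field
    ≈ₚ-resp     : ∀ {σ τ} → σ ≈ₚ τ → G σ → G τ
    ∘ₚ-closed   : ∀ {σ τ} → G σ → G τ → G (σ ∘ₚ τ)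
    flip-closed : ∀ {σ} → G σ → G (flip σ)

-- Elements hᵢ meeting every left coset σGₓ of the stabilizer, such that hⱼ⁻¹ hᵢ is
-- a derangement unless hᵢ = hⱼ.
record SharpTransversal (G : Perm n → Set) (x : Fin n) : Set₁ where
  field
    Index     : Set
    h         : Index → Perm n
    h∈G       : ∀ i → G (h i)
    reaches   : ∀ σ → G σ → ∃ λ i → h i ⟨$⟩ʳ x ≡ σ ⟨$⟩ʳ x
    sharp     : ∀ i j p → h i ⟨$⟩ʳ p ≡ h j ⟨$⟩ʳ p → h i ≈ₚ h j

module Transversal {G : Perm n → Set} {x : Fin n} (H : SharpTransversal G x) where
  open SharpTransversal H

  infix 4 _∈H·_

  _∈H·_ : Perm n → Perm n → Set
  σ ∈H· τ = ∃ λ i → σ ≈ₚ (τ ∘ₚ h i)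

  intersecting⇒≈ₚ : ∀ {σ σ′ τ} → Intersect σ σ′ → σ ∈H· τ → σ′ ∈H· τ → σ ≈ₚ σ′
  intersecting⇒≈ₚ {σ} {σ′} {τ} (k , σq≡k) (i , σ≈hᵢτ) (j , σ′≈hⱼτ) p = begin
    σ ⟨$⟩ʳ p             ≡⟨ σ≈hᵢτ p ⟩
    h i ⟨$⟩ʳ (τ ⟨$⟩ʳ p)  ≡⟨ hᵢ≈hⱼ (τ ⟨$⟩ʳ p) ⟩
    h j ⟨$⟩ʳ (τ ⟨$⟩ʳ p)  ≡⟨ σ′≈hⱼτ p ⟨
    σ′ ⟨$⟩ʳ p            ∎
    where
    open ≡-Reasoning
    q = σ′ ⟨$⟩ˡ k
    σq≡σ′q : σ ⟨$⟩ʳ q ≡ σ′ ⟨$⟩ʳ q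
    σq≡σ′q = trans σq≡k (sym (inverseʳ σ′))
    hᵢ≈hⱼ : h i ≈ₚ h j
    hᵢ≈hⱼ = sharp i j (τ ⟨$⟩ʳ q) (trans (sym (σ≈hᵢτ q)) (trans σq≡σ′q (σ′≈hⱼτ q)))

  module _ (group : IsPermutationGroup G) where
    open IsPermutationGroup group

    stabilizerFactor : ∀ {σ} → G σ → ∃ λ τ → (G τ × τ ⟨$⟩ʳ x ≡ x) × σ ∈H· τ
    stabilizerFactor {σ} Gσ with reaches σ Gσ
    ... | i , hᵢx≡σx = σ ∘ₚ flip (h i) , (∘ₚ-closed Gσ (flip-closed (h∈G i)) , τx≡x) ,
                       i , λ _ → sym (inverseʳ (h i))
      where
      τx≡x : h i ⟨$⟩ˡ (σ ⟨$⟩ʳ x) ≡ x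
      τx≡x = trans (cong (h i ⟨$⟩ˡ_) (sym hᵢx≡σx)) (inverseˡ (h i))

stabilizerEnumeration : ∀ {G : Perm n → Set} → IsPermutationGroup G → Decidable G →
                        ∀ x → ∃ (EnumeratesStabilizer G x)
stabilizerEnumeration {G = G} group G? x =
  let T , T⊆Gₓ , T-distinct , T-complete = enumerate (λ σ → G? σ ×-dec (σ ⟨$⟩ʳ x ≟ᶠ x)) stabilizer-resp
  in  T , T⊆Gₓ , T-distinct , λ σ Gσ σx≡x → T-complete σ (Gσ , σx≡x)
  where
  open IsPermutationGroup group
  stabilizer-resp : ∀ {σ τ} → σ ≈ₚ τ → G σ × σ ⟨$⟩ʳ x ≡ x → G τ × τ ⟨$⟩ʳ x ≡ x
  stabilizer-resp σ≈τ (Gσ , σx≡x) = ≈ₚ-resp σ≈τ Gσ , trans (sym (σ≈τ x)) σx≡x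

sharpTransversal⇒EKR : ∀ {G : Perm n → Set} {x} → IsPermutationGroup G → Decidable G →
                       SharpTransversal G x → EKR G
sharpTransversal⇒EKR {G = G} {x} group G? H S ((S⊆G , S-distinct) , S-intersecting)
  with stabilizerEnumeration group G? x
... | T , T-enumerates@(_ , _ , T-complete) =
  x , T , T-enumerates ,
  placement⇒length≤ (All.map placed S⊆G) (AllPairs.zipWith (λ {σ} {σ′} → apart {σ} {σ′}) (S-distinct , S-intersecting))
  where
  open SharpTransversal H using (h)
  open Transversal H

  placed : ∀ {σ} → G σ → Any (σ ∈H·_) T
  placed Gσ = let τ , (Gτ , τx≡x) , i , σ≈hᵢτ = stabilizerFactor group Gσ in
    Any.map (λ τ≈ρ → i , λ p → trans (σ≈hᵢτ p) (cong (h i ⟨$⟩ʳ_) (τ≈ρ p))) (T-complete τ Gτ τx≡x)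

  apart : ∀ {σ σ′} → Distinct σ σ′ × Intersect σ σ′ → ∀ {ρ} → σ ∈H· ρ → σ′ ∈H· ρ → ⊥
  apart {σ} {σ′} (σ≉σ′ , σ∩σ′) {ρ} σ∈ σ′∈ = σ≉σ′ (intersecting⇒≈ₚ {σ} {σ′} {ρ} σ∩σ′ σ∈ σ′∈)

-- Blocks of a composition

data Position (a : ℕ) : ℕ → Set where
  inside : ∀ {o} → o < a → Position a o
  beyond : ∀ m → Position a (a + m)

position : ∀ a m → Position a m
position a m with m <? a
... | yes m<a = inside m<a
... | no  m≮a = subst (Position a) (m+[n∸m]≡n (≮⇒≥ m≮a)) (beyond (m ∸ a))

<ᵇ-inside : ∀ {o a} → o < a → (o <ᵇ a) ≡ true
<ᵇ-inside z<s       = refl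
<ᵇ-inside {suc o} (s≤s o<a) = <ᵇ-inside o<a

<ᵇ-beyond : ∀ a m → (a + m <ᵇ a) ≡ false
<ᵇ-beyond zero    m = refl
<ᵇ-beyond (suc a) m = <ᵇ-beyond a m

block-inside : ∀ {o a} l → o < a → block (a ∷ l) o ≡ 0
block-inside l o<a rewrite <ᵇ-inside o<a = refl

block-beyond : ∀ a l m → block (a ∷ l) (a + m) ≡ suc (block l m)
block-beyond a l m rewrite <ᵇ-beyond a m | m+n∸m≡n a m = refl

blockwise : (ℕ → ℕ → ℕ) → List ℕ → ℕ → ℕ
blockwise f []      m = m
blockwise f (a ∷ l) m = if m <ᵇ a then f a m else a + blockwise f l (m ∸ a)

blockwise-inside : ∀ {f o a} l → o < a → blockwise f (a ∷ l) o ≡ f a o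
blockwise-inside l o<a rewrite <ᵇ-inside o<a = refl

blockwise-beyond : ∀ {f} a l m → blockwise f (a ∷ l) (a + m) ≡ a + blockwise f l m
blockwise-beyond a l m rewrite <ᵇ-beyond a m | m+n∸m≡n a m = refl

module _ {f : ℕ → ℕ → ℕ} where

  module _ (f< : ∀ {a o} → o < a → f a o < a) where

    blockwise-< : ∀ l {m} → m < sum l → blockwise f l m < sum l
    blockwise-< (a ∷ l) {m} m<Σ with position a m
    ... | inside o<a rewrite blockwise-inside {f} l o<a = <-≤-trans (f< o<a) (m≤m+n a (sum l))
    ... | beyond k   rewrite blockwise-beyond {f} a l k =
      +-monoʳ-< a (blockwise-< l (+-cancelˡ-< a k (sum l) m<Σ))

    block-blockwise : ∀ l m → block l (blockwise f l m) ≡ block l m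
    block-blockwise []      m = refl
    block-blockwise (a ∷ l) m with position a m
    ... | inside o<a rewrite blockwise-inside {f} l o<a = trans (block-inside l (f< o<a)) (sym (block-inside l o<a))
    ... | beyond k   rewrite blockwise-beyond {f} a l k | block-beyond a l (blockwise f l k) | block-beyond a l k =
      cong suc (block-blockwise l k)

    blockwise-inverse : ∀ {g} {l} → All (λ a → ∀ {o} → o < a → g a (f a o) ≡ o) l →
                        ∀ m → blockwise g l (blockwise f l m) ≡ m
    blockwise-inverse []                m = refl
    blockwise-inverse {g} {a ∷ l} (g∘f ∷ gs∘fs) m with position a m
    ... | inside o<a rewrite blockwise-inside {f} l o<a | blockwise-inside {g} l (f< o<a) = g∘f o<a
    ... | beyond k   rewrite blockwise-beyond {f} a l k | blockwise-beyond {g} a l (blockwise f l k) =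
      cong (a +_) (blockwise-inverse gs∘fs k)

  blockwise-++ : ∀ pre {l} m → blockwise f (pre ++ l) (sum pre + m) ≡ sum pre + blockwise f l m
  blockwise-++ []        m = refl
  blockwise-++ (a ∷ pre) {l} m = begin
    blockwise f (a ∷ pre ++ l) (a + sum pre + m)   ≡⟨ cong (blockwise f (a ∷ pre ++ l)) (+-assoc a (sum pre) m) ⟩
    blockwise f (a ∷ pre ++ l) (a + (sum pre + m)) ≡⟨ blockwise-beyond {f} a (pre ++ l) (sum pre + m) ⟩
    a + blockwise f (pre ++ l) (sum pre + m)       ≡⟨ cong (a +_) (blockwise-++ pre m) ⟩
    a + (sum pre + blockwise f l m)                ≡⟨ +-assoc a (sum pre) (blockwise f l m) ⟨
    a + sum pre + blockwise f l m                  ∎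
    where open ≡-Reasoning

block-++ : ∀ pre {l} m → block (pre ++ l) (sum pre + m) ≡ length pre + block l m
block-++ []        m = refl
block-++ (a ∷ pre) {l} m rewrite +-assoc a (sum pre) m | block-beyond a (pre ++ l) (sum pre + m) =
  cong suc (block-++ pre m)

block≡length⇒offset : ∀ pre {c post y} → block (pre ++ c ∷ post) y ≡ length pre →
                      ∃ λ o → o < c × y ≡ sum pre + o
block≡length⇒offset [] {c} {post} {y} block≡0 with position c y
... | inside o<c = _ , o<c , refl
... | beyond k   rewrite block-beyond c post k with () ← block≡0
block≡length⇒offset (a ∷ pre) {c} {post} {y} block≡ with position a y
... | inside o<a rewrite block-inside (pre ++ c ∷ post) o<a with () ← block≡
... | beyond k   rewrite block-beyond a (pre ++ c ∷ post) k =
  let o , o<c , k≡ = block≡length⇒offset pre (suc-injective block≡) in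
  o , o<c , trans (cong (a +_) k≡) (sym (+-assoc a (sum pre) o))

block-start : ∀ pre {c post} → 0 < c → block (pre ++ c ∷ post) (sum pre) ≡ length pre
block-start pre {c} {post} c>0 = begin
  block (pre ++ c ∷ post) (sum pre)     ≡⟨ cong (block (pre ++ c ∷ post)) (+-identityʳ (sum pre)) ⟨
  block (pre ++ c ∷ post) (sum pre + 0) ≡⟨ block-++ pre 0 ⟩
  length pre + block (c ∷ post) 0       ≡⟨ cong (length pre +_) (block-inside post c>0) ⟩
  length pre + 0                        ≡⟨ +-identityʳ (length pre) ⟩
  length pre                            ∎
  where open ≡-Reasoning

-- Rotating every block

[m%n+k]%n≡[m+k]%n : ∀ m k n .{{_ : NonZero n}} → (m % n + k) % n ≡ (m + k) % n
[m%n+k]%n≡[m+k]%n m k n = begin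
  (m % n + k) % n         ≡⟨ %-distribˡ-+ (m % n) k n ⟩
  (m % n % n + k % n) % n ≡⟨ cong (λ t → (t + k % n) % n) (m%n%n≡m%n m n) ⟩
  (m % n + k % n) % n     ≡⟨ %-distribˡ-+ m k n ⟨
  (m + k) % n             ∎
  where open ≡-Reasoning

-- The clause for a = 0 is junk (there is no offset o < 0); it is only there because
-- _%_ needs a nonzero modulus.
rotate : ℕ → ℕ → ℕ → ℕ
rotate r zero    o = o
rotate r (suc a) o = (o + r) % suc a

rotate-< : ∀ {r a o} → o < a → rotate r a o < a
rotate-< {r} {suc a} {o} _ = m%n<n (o + r) (suc a)

rotate-zero : ∀ {r a} → r < a → rotate r a 0 ≡ r
rotate-zero {a = suc a} r<a = m<n⇒m%n≡m r<a

rotate-inverseˡ : ∀ {r a} → r ≤ a → ∀ {o} → o < a → rotate (a ∸ r) a (rotate r a o) ≡ o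
rotate-inverseˡ {r} {suc a} r≤a {o} o<a = begin
  ((o + r) % b + (b ∸ r)) % b ≡⟨ [m%n+k]%n≡[m+k]%n (o + r) (b ∸ r) b ⟩
  (o + r + (b ∸ r)) % b       ≡⟨ cong (_% b) (trans (+-assoc o r (b ∸ r)) (cong (o +_) (m+[n∸m]≡n r≤a))) ⟩
  (o + b) % b                 ≡⟨ [m+n]%n≡m%n o b ⟩
  o % b                       ≡⟨ m<n⇒m%n≡m o<a ⟩
  o                           ∎
  where
  b = suc a
  open ≡-Reasoning

rotate-inverseʳ : ∀ {r a} → r ≤ a → ∀ {o} → o < a → rotate r a (rotate (a ∸ r) a o) ≡ o
rotate-inverseʳ {r} {a} r≤a o<a =
  subst (λ s → rotate s a (rotate (a ∸ r) a _) ≡ _) (m∸[m∸n]≡n r≤a) (rotate-inverseˡ (m∸n≤m a r) o<a)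

rotate-cancelˡ : ∀ {r r′ a o} → r < a → r′ < a → o < a → rotate r a o ≡ rotate r′ a o → r ≡ r′
rotate-cancelˡ {r} {r′} {suc a} {o} r<a r′<a o<a rotᵣ≡rotᵣ′ = begin
  r                                  ≡⟨ rotate-inverseˡ (<⇒≤ o<a) r<a ⟨
  rotate (b ∸ o) b ((r + o) % b)     ≡⟨ cong (rotate (b ∸ o) b) (begin
    (r + o) % b                        ≡⟨ cong (_% b) (+-comm r o) ⟩
    (o + r) % b                        ≡⟨ rotᵣ≡rotᵣ′ ⟩
    (o + r′) % b                       ≡⟨ cong (_% b) (+-comm o r′) ⟩
    (r′ + o) % b                       ∎) ⟩
  rotate (b ∸ o) b ((r′ + o) % b)    ≡⟨ rotate-inverseˡ (<⇒≤ o<a) r′<a ⟩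
  r′                                 ∎
  where
  b = suc a
  open ≡-Reasoning

shift : ℕ → List ℕ → ℕ → ℕ
shift r = blockwise (rotate r)

unshift : ℕ → List ℕ → ℕ → ℕ
unshift r = blockwise λ a → rotate (a ∸ r) a

shift-cancelˡ : ∀ {r r′} l → All (r <_) l → All (r′ <_) l → ∀ {m} → m < sum l →
                shift r l m ≡ shift r′ l m → r ≡ r′
shift-cancelˡ (a ∷ l) (r<a ∷ r<l) (r′<a ∷ r′<l) {m} m<Σ shiftᵣ≡shiftᵣ′ with position a m
... | inside o<a = rotate-cancelˡ r<a r′<a o<a
  (trans (sym (blockwise-inside l o<a)) (trans shiftᵣ≡shiftᵣ′ (blockwise-inside l o<a)))
... | beyond k   = shift-cancelˡ l r<l r′<l (+-cancelˡ-< a k (sum l) m<Σ) (+-cancelˡ-≡ a _ _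
  (trans (sym (blockwise-beyond a l k)) (trans shiftᵣ≡shiftᵣ′ (blockwise-beyond a l k))))

shift-start : ∀ pre {c post r} → r < c → shift r (pre ++ c ∷ post) (sum pre) ≡ sum pre + r
shift-start pre {c} {post} {r} r<c = begin
  shift r (pre ++ c ∷ post) (sum pre)     ≡⟨ cong (shift r (pre ++ c ∷ post)) (+-identityʳ (sum pre)) ⟨
  shift r (pre ++ c ∷ post) (sum pre + 0) ≡⟨ blockwise-++ pre 0 ⟩
  sum pre + shift r (c ∷ post) 0          ≡⟨ cong (sum pre +_) (blockwise-inside post (≤-trans (s≤s z≤n) r<c)) ⟩
  sum pre + rotate r c 0                  ≡⟨ cong (sum pre +_) (rotate-zero r<c) ⟩
  sum pre + r                             ∎
  where open ≡-Reasoning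

shiftBijection : ∀ r l → All (r ≤_) l → BijectionBelow (sum l)
shiftBijection r l r≤l = record
  { to      = shift r l
  ; from    = unshift r l
  ; to-<    = blockwise-< rotate-< l
  ; from-<  = blockwise-< rotate-< l
  ; from∘to = λ {m} _ → blockwise-inverse rotate-< (All.map rotate-inverseˡ r≤l) m
  ; to∘from = λ {m} _ → blockwise-inverse rotate-< (All.map rotate-inverseʳ r≤l) m
  }

-- Young subgroups

module _ (l : List ℕ) where

  InYoung-isPermutationGroup : ∀ {n} → IsPermutationGroup (InYoung {n} l)
  InYoung-isPermutationGroup = record
    { ≈ₚ-resp     = λ σ≈τ σ∈G i → trans (cong (block l ∘ toℕ) (sym (σ≈τ i))) (σ∈G i)
    ; ∘ₚ-closed   = λ {σ} σ∈G τ∈G i → trans (τ∈G (σ ⟨$⟩ʳ i)) (σ∈G i)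
    ; flip-closed = λ {σ} σ∈G i → trans (sym (σ∈G (σ ⟨$⟩ˡ i))) (cong (block l ∘ toℕ) (inverseʳ σ))
    }

  InYoung? : ∀ {n} → Decidable (InYoung {n} l)
  InYoung? σ = all? λ i → block l (toℕ (σ ⟨$⟩ʳ i)) ≟ block l (toℕ i)

  shiftPermutation : ∀ r → All (r ≤_) l → Perm (sum l)
  shiftPermutation r r≤l = toPermutation (shiftBijection r l r≤l)

  shiftPermutation∈Young : ∀ r r≤l → InYoung l (shiftPermutation r r≤l)
  shiftPermutation∈Young r r≤l i = trans (cong (block l) (toℕ-toPermutation (shiftBijection r l r≤l) i))
                                         (block-blockwise rotate-< l (toℕ i))

module _ (pre : List ℕ) (c : ℕ) (post : List ℕ) (c>0 : 0 < c) (c≤l : All (c ≤_) (pre ++ c ∷ post)) where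

  private
    l = pre ++ c ∷ post

  firstPointOfBlock : Fin (sum l)
  firstPointOfBlock = fromℕ< (subst (sum pre <_) (sym (sum-++ pre (c ∷ post)))
                                    (m<m+n (sum pre) (≤-trans c>0 (m≤m+n c (sum post)))))

  private
    x = firstPointOfBlock

    i<l : (i : Fin c) → All (toℕ i <_) l
    i<l i = All.map (<-≤-trans (toℕ<n i)) c≤l

    i≤l : (i : Fin c) → All (toℕ i ≤_) l
    i≤l i = All.map <⇒≤ (i<l i)

    h : Fin c → Perm (sum l)
    h i = shiftPermutation l (toℕ i) (i≤l i)

    toℕ-h : ∀ i p → toℕ (h i ⟨$⟩ʳ p) ≡ shift (toℕ i) l (toℕ p)
    toℕ-h i = toℕ-toPermutation (shiftBijection (toℕ i) l (i≤l i))

    block-σx : ∀ σ → InYoung l σ → block l (toℕ (σ ⟨$⟩ʳ x)) ≡ length pre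
    block-σx σ σ∈G = trans (σ∈G x) (trans (cong (block l) (toℕ-fromℕ< _)) (block-start pre c>0))

    reaches : ∀ σ → InYoung l σ → ∃ λ i → h i ⟨$⟩ʳ x ≡ σ ⟨$⟩ʳ x
    reaches σ σ∈G with block≡length⇒offset pre (block-σx σ σ∈G)
    ... | o , o<c , σx≡ = fromℕ< o<c , toℕ-injective (begin
      toℕ (h (fromℕ< o<c) ⟨$⟩ʳ x)         ≡⟨ toℕ-h (fromℕ< o<c) x ⟩
      shift (toℕ (fromℕ< o<c)) l (toℕ x) ≡⟨ cong₂ (λ r p → shift r l p) (toℕ-fromℕ< o<c) (toℕ-fromℕ< _) ⟩
      shift o l (sum pre)                ≡⟨ shift-start pre o<c ⟩
      sum pre + o                        ≡⟨ σx≡ ⟨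
      toℕ (σ ⟨$⟩ʳ x)                      ∎)
      where open ≡-Reasoning

    sharp : ∀ i j p → h i ⟨$⟩ʳ p ≡ h j ⟨$⟩ʳ p → h i ≈ₚ h j
    sharp i j p hᵢp≡hⱼp q = cong (λ k → h k ⟨$⟩ʳ q) (toℕ-injective
      (shift-cancelˡ l (i<l i) (i<l j) (toℕ<n p)
        (trans (sym (toℕ-h i p)) (trans (cong toℕ hᵢp≡hⱼp) (toℕ-h j p)))))

  shiftTransversal : SharpTransversal (InYoung l) firstPointOfBlock
  shiftTransversal = record
    { Index   = Fin c
    ; h       = h
    ; h∈G     = λ i → shiftPermutation∈Young l (toℕ i) (i≤l i)
    ; reaches = reaches
    ; sharp   = sharp
    }

young-EKR : ∀ pre c post → 0 < c → All (c ≤_) (pre ++ c ∷ post) → EKR (InYoung (pre ++ c ∷ post))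
young-EKR pre c post c>0 c≤l =
  sharpTransversal⇒EKR (InYoung-isPermutationGroup l) (InYoung? l) (shiftTransversal pre c post c>0 c≤l)
  where l = pre ++ c ∷ post

corollary5p5 : (n : ℕ) (λs : List ℕ) → IsPartition n λs → EKR {n} (InYoung λs)
corollary5p5 .(sum λs) λs (λs≢[] , positive , _ , refl) =
  let c , c∈λs , c≤λs = minimum λs λs≢[]
      pre , post , λs≡ = ∈-∃++ c∈λs
  in  subst (λ l → EKR {sum l} (InYoung l)) (sym λs≡)
            (young-EKR pre c post (All.lookup positive c∈λs) (subst (All (c ≤_)) λs≡ c≤λs))
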